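{- Every formula of BR is equivalent over (finite) data words to a formula of the $\nu$-fragment.
   Context: Data words are finite sequences over $\Sigma\times\mathcal D$ ($\Sigma$ finite alphabet, $\mathcal D$ infinite); $i\sim j$ iff positions $i,j$ carry the same data value; the class successor/predecessor of $i$ is the nearest later/earlier position $j\sim i$. $\mu$-calculus: $\varphi::= x\mid A\mid\neg A\mid \mathsf M\varphi\mid\varphi\vee\varphi\mid\varphi\wedge\varphi\mid\mu x.\varphi\mid\nu x.\varphi$, with fixpoint variables $x$, atoms $A$: letters of $\Sigma$ and zeroary $\mathsf S,\mathsf P,\mathsf{first}^g,\mathsf{last}^g,\mathsf{first}^c,\mathsf{last}^c$; unary modalities $\mathsf M\in\{\mathtt X^g,\mathtt X^c,\mathtt Y^g,\mathtt Y^c\}$ evaluating the argument at the successor, class successor, predecessor, class predecessor respectively (false if nonexistent). Letters hold where they label the position; $\mathsf{first}^g$/$\mathsf{last}^g$ at the first/last position; $\mathsf{first}^c$/$\mathsf{last}^c$ where there is no class predecessor/successor; $\mathsf S$ at $i$ iff $i$ is not last and $i+1$ is the class successor of $i$; $\mathsf P$ at $i$ iff $i\ne1$ and $i-1$ is the class predecessor of $i$; $\mu,\nu$ least/greatest fixpoints. Equivalence: same denotation on every data word. The $\nu$-fragment: formulas without $\mu$. For a set $M$ of unary modalities, $\mathsf{Formulas}(M)$ is the set of formulas whose unary modalities all lie in $M$. For a set $\Psi$ of formulas: $\mathsf{Comp}^0(\Psi)=\emptyset$; $\mathsf{Comp}^{i+1}(\Psi)=\{\psi(\varphi_1,\dots,\varphi_n)\mid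 \psi(x_1,\dots,x_n)\in\Psi,\ \varphi_j\in\mathsf{Comp}^i(\Psi)\}$ ($\psi$ with free variables among $x_1,\dots,x_n$, capture-avoiding substitution); $\mathsf{Comp}(\Psi)=\bigcup_i\mathsf{Comp}^i(\Psi)$. BR $=\mathsf{Comp}(\mathsf{Formulas}(\{\mathtt X^c,\mathtt X^g\})\cup\mathsf{Formulas}(\{\mathtt Y^c,\mathtt Y^g\}))$. -}

module Defs where

open import Data.Nat using (ℕ; zero; suc; _<_)
open import Data.Fin using (Fin; zero; suc; toℕ)
open import Data.Bool using (Bool; true)
open import Data.Product using (Σ; _×_; _,_)
open import Data.Sum using (_⊎_)
open import Data.Empty using (⊥)
open import Relation.Nullary using (¬_)
open import Relation.Binary.PropositionalEquality using (_≡_; _≢_)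

-- Data words over Σ × 𝒟 with Σ = Fin k and 𝒟 = ℕ (an infinite set).
-- Positions of a word of length n are Fin n (0-based).

record Word (k : ℕ) : Set where
  field
    len : ℕ
    lab : Fin len → Fin k
    dat : Fin len → ℕ
open Word public

module _ {k : ℕ} (w : Word k) where
  Succ : Fin (len w) → Fin (len w) → Set
  Succ i j = toℕ j ≡ suc (toℕ i)

  ClassSucc : Fin (len w) → Fin (len w) → Set
  ClassSucc i j = (toℕ i < toℕ j) × (dat w j ≡ dat w i)
    × (∀ l → toℕ i < toℕ l → toℕ l < toℕ j → dat w l ≢ dat w i)

-- Syntax (well-scoped de Bruijn: Fml k m has free fixpoint variables
-- among Fin m; var zero refers to the innermost binder).

data Atom (k : ℕ) : Set where
  letter : Fin k → Atom k
  S P firstg lastg firstc lastc : Atom k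

data Mod : Set where
  Xg Xc Yg Yc : Mod

data Fml (k : ℕ) (m : ℕ) : Set where
  var      : Fin m → Fml k m
  pos      : Atom k → Fml k m
  neg      : Atom k → Fml k m
  modal    : Mod → Fml k m → Fml k m
  _∨'_ _∧'_ : Fml k m → Fml k m → Fml k m
  μ' ν'    : Fml k (suc m) → Fml k m

Valuation : ℕ → ℕ → Set
Valuation m n = Fin m → Fin n → Bool

_∷ᵛ_ : ∀ {m n} → (Fin n → Bool) → Valuation m n → Valuation (suc m) n
(X ∷ᵛ ρ) zero    = X
(X ∷ᵛ ρ) (suc x) = ρ x

module _ {k : ℕ} (w : Word k) where
  Pos = Fin (len w)

  ⟦_⟧ᴬ : Atom k → Pos → Set
  ⟦ letter a ⟧ᴬ i = lab w i ≡ a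
  ⟦ S ⟧ᴬ i = Σ Pos λ j → Succ w i j × ClassSucc w i j
  ⟦ P ⟧ᴬ i = Σ Pos λ j → Succ w j i × ClassSucc w j i
  ⟦ firstg ⟧ᴬ i = toℕ i ≡ 0
  ⟦ lastg ⟧ᴬ i = suc (toℕ i) ≡ len w
  ⟦ firstc ⟧ᴬ i = ¬ (Σ Pos λ j → ClassSucc w j i)
  ⟦ lastc ⟧ᴬ i = ¬ (Σ Pos λ j → ClassSucc w i j)

  Step : Mod → Pos → Pos → Set
  Step Xg i j = Succ w i j
  Step Xc i j = ClassSucc w i j
  Step Yg i j = Succ w j i
  Step Yc i j = ClassSucc w j i

  ⟦_⟧ : ∀ {m} → Fml k m → Valuation m (len w) → Pos → Set
  ⟦ var x ⟧ ρ i = ρ x i ≡ true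
  ⟦ pos A ⟧ ρ i = ⟦ A ⟧ᴬ i
  ⟦ neg A ⟧ ρ i = ¬ ⟦ A ⟧ᴬ i
  ⟦ modal M φ ⟧ ρ i = Σ Pos λ j → Step M i j × ⟦ φ ⟧ ρ j
  ⟦ φ ∨' ψ ⟧ ρ i = ⟦ φ ⟧ ρ i ⊎ ⟦ ψ ⟧ ρ i
  ⟦ φ ∧' ψ ⟧ ρ i = ⟦ φ ⟧ ρ i × ⟦ ψ ⟧ ρ i
  -- least fixpoint: intersection of all pre-fixpoints (Knaster–Tarski)
  ⟦ μ' φ ⟧ ρ i = (X : Pos → Bool) → (∀ j → ⟦ φ ⟧ (X ∷ᵛ ρ) j → X j ≡ true) → X i ≡ true
  -- greatest fixpoint: union of all post-fixpoints (Knaster–Tarski)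
  ⟦ ν' φ ⟧ ρ i = Σ (Pos → Bool) λ X → (X i ≡ true) × (∀ j → X j ≡ true → ⟦ φ ⟧ (X ∷ᵛ ρ) j)

emptyVal : ∀ {n} → Valuation 0 n
emptyVal ()

Equiv : ∀ {k} → Fml k 0 → Fml k 0 → Set
Equiv {k} φ ψ = (w : Word k) (i : Fin (len w)) →
  (⟦ w ⟧ φ emptyVal i → ⟦ w ⟧ ψ emptyVal i) × (⟦ w ⟧ ψ emptyVal i → ⟦ w ⟧ φ emptyVal i)

data NuFrag {k : ℕ} : ∀ {m} → Fml k m → Set where
  var   : ∀ {m} (x : Fin m) → NuFrag (var x)
  pos   : ∀ {m} (A : Atom k) → NuFrag {m = m} (pos A)
  neg   : ∀ {m} (A : Atom k) → NuFrag {m = m} (neg A)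
  modal : ∀ {m} M {φ : Fml k m} → NuFrag φ → NuFrag (modal M φ)
  or    : ∀ {m} {φ ψ : Fml k m} → NuFrag φ → NuFrag ψ → NuFrag (φ ∨' ψ)
  and   : ∀ {m} {φ ψ : Fml k m} → NuFrag φ → NuFrag ψ → NuFrag (φ ∧' ψ)
  nu    : ∀ {m} {φ : Fml k (suc m)} → NuFrag φ → NuFrag (ν' φ)

data Formulas {k : ℕ} (M : Mod → Set) : ∀ {m} → Fml k m → Set where
  var   : ∀ {m} (x : Fin m) → Formulas M (var x)
  pos   : ∀ {m} (A : Atom k) → Formulas M {m} (pos A)
  neg   : ∀ {m} (A : Atom k) → Formulas M {m} (neg A)
  modal : ∀ {m} {N} {φ : Fml k m} → M N → Formulas M φ → Formulas M (modal N φ)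
  or    : ∀ {m} {φ ψ : Fml k m} → Formulas M φ → Formulas M ψ → Formulas M (φ ∨' ψ)
  and   : ∀ {m} {φ ψ : Fml k m} → Formulas M φ → Formulas M ψ → Formulas M (φ ∧' ψ)
  mu    : ∀ {m} {φ : Fml k (suc m)} → Formulas M φ → Formulas M (μ' φ)
  nu    : ∀ {m} {φ : Fml k (suc m)} → Formulas M φ → Formulas M (ν' φ)

Future : Mod → Set
Future M = (M ≡ Xc) ⊎ (M ≡ Xg)

Past : Mod → Set
Past M = (M ≡ Yc) ⊎ (M ≡ Yg)

ext : ∀ {m m'} → (Fin m → Fin m') → Fin (suc m) → Fin (suc m')
ext r zero    = zero
ext r (suc x) = suc (r x)

ren : ∀ {k m m'} → (Fin m → Fin m') → Fml k m → Fml k m'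
ren r (var x)     = var (r x)
ren r (pos A)     = pos A
ren r (neg A)     = neg A
ren r (modal M φ) = modal M (ren r φ)
ren r (φ ∨' ψ)    = ren r φ ∨' ren r ψ
ren r (φ ∧' ψ)    = ren r φ ∧' ren r ψ
ren r (μ' φ)      = μ' (ren (ext r) φ)
ren r (ν' φ)      = ν' (ren (ext r) φ)

exts : ∀ {k m m'} → (Fin m → Fml k m') → Fin (suc m) → Fml k (suc m')
exts σ zero    = var zero
exts σ (suc x) = ren suc (σ x)

sub : ∀ {k m m'} → (Fin m → Fml k m') → Fml k m → Fml k m'
sub σ (var x)     = σ x
sub σ (pos A)     = pos A
sub σ (neg A)     = neg A
sub σ (modal M φ) = modal M (sub σ φ)
sub σ (φ ∨' ψ)    = sub σ φ ∨' sub σ ψ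
sub σ (φ ∧' ψ)    = sub σ φ ∧' sub σ ψ
sub σ (μ' φ)      = μ' (sub (exts σ) φ)
sub σ (ν' φ)      = ν' (sub (exts σ) φ)

-- Comp^{i+1}(Ψ) = { ψ(φ_1,…,φ_m) | ψ ∈ Ψ with free vars among x_1..x_m,
--                                   φ_j ∈ Comp^i(Ψ) }.
-- (Comp^0 = ∅, so every member of Comp^i is closed.)

FormulaSet : ℕ → Set₁
FormulaSet k = ∀ {m} → Fml k m → Set

CompN : ∀ {k} → FormulaSet k → ℕ → Fml k 0 → Set
CompN Ψ zero    φ = ⊥
CompN {k} Ψ (suc i) φ =
  Σ ℕ λ m → Σ (Fml k m) λ ψ → Ψ ψ × Σ (Fin m → Fml k 0) λ σ →
    (∀ j → CompN Ψ i (σ j)) × (φ ≡ sub σ ψ)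

Comp : ∀ {k} → FormulaSet k → Fml k 0 → Set
Comp Ψ φ = Σ ℕ λ i → CompN Ψ i φ

BRgen : ∀ {k} → FormulaSet k
BRgen ψ = Formulas Future ψ ⊎ Formulas Past ψ

BR : ∀ {k} → Fml k 0 → Set
BR = Comp BRgen

-- Fix a direction D (the future modalities X^c, X^g or the past ones Y^c, Y^g).
-- Every D-step strictly increases a bounded rank on positions (the position
-- itself, resp. its distance to the end of the word).  Hence a D-formula
-- evaluated at j only looks at the valuation at ranks ≥ rank j, and, for a
-- variable x guarded in it (occurring only under modalities), only at ranks
-- > rank j.  By downward induction on the rank, a fixpoint whose variable is
-- guarded is unique: μx.φ ≡ νx.φ.  An arbitrary μx.φ is first rewritten to
-- μx.guard φ, where `guard` replaces the unguarded occurrences of x by false,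
-- unfolding the inner fixpoints once (an unguarded inner μy / νy variable is
-- replaced by false / true at the current position).  Replacing every μx.φ
-- by νx.guard φ (`toNu`) thus turns every one-directional formula into an
-- equivalent ν-formula.

module Submission where

open import Defs
open import Data.Nat using (ℕ; zero; suc; _≤_; _<_; _∸_; _≤?_; _<?_; s≤s)
import Data.Nat as ℕ
open import Data.Nat.Properties
  using (≤-refl; ≤-trans; <⇒≤; <-≤-trans; ≤-<-trans; ≤-reflexive; <-irrefl; ∸-monoʳ-<; m∸n≤m)
open import Data.Fin using (Fin; zero; suc; toℕ)
import Data.Fin as Fin
open import Data.Fin.Properties using (toℕ<n; any?; all?)
open import Data.Fin.Subset.Properties using (anySubset?)
open import Data.Bool using (Bool; true; false)
import Data.Bool as Bool
open import Data.Vec using (lookup; tabulate)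
open import Data.Vec.Properties using (lookup∘tabulate)
open import Data.Vec.Functional using (updateAt)
open import Data.Vec.Functional.Properties using (updateAt-updates; updateAt-minimal)
open import Data.Product using (Σ; _×_; _,_; proj₁; proj₂)
open import Data.Product.Function.NonDependent.Propositional using (_×-⇔_)
open import Data.Sum using (_⊎_; inj₁; inj₂)
open import Data.Sum.Function.Propositional using (_⊎-⇔_)
open import Data.Empty using (⊥; ⊥-elim)
open import Function using (_∘_; const; id)
open import Function.Bundles using (_⇔_; mk⇔; Equivalence)
open import Function.Related.Propositional using (module EquationalReasoning; Kind)
import Function.Properties.Equivalence as ⇔
open import Relation.Nullary using (¬_; Dec; yes; no; does)
open import Relation.Nullary.Decidable
  using (map′; _×-dec_; _⊎-dec_; _→-dec_; ¬?; decidable-stable; toSum)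
open import Relation.Binary.PropositionalEquality
  using (_≡_; _≢_; refl; sym; trans; cong; _≗_; ≢-sym)

open Equivalence using (to; from)
open EquationalReasoning {k = Kind.equivalence}

does-true : ∀ {A : Set} (d : Dec A) → (does d ≡ true) ⇔ A
does-true (yes a) = mk⇔ (λ _ → a) (λ _ → refl)
does-true (no ¬a) = mk⇔ (λ ()) (λ a → ⊥-elim (¬a a))

false≢true : false ≢ true
false≢true ()

true-unless-false : ∀ (b : Bool) → (b ≡ false → b ≡ true) → b ≡ true
true-unless-false true  _ = refl
true-unless-false false h = h refl

_⊆_ : ∀ {n} → (Fin n → Bool) → (Fin n → Bool) → Set
X ⊆ X' = ∀ l → X l ≡ true → X' l ≡ true

⊆-refl : ∀ {n} {X : Fin n → Bool} → X ⊆ X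
⊆-refl _ = id

≗⇒⊆ : ∀ {n} {X X' : Fin n → Bool} → X ≗ X' → X ⊆ X'
≗⇒⊆ e l = trans (sym (e l))

_[_]≔_ : ∀ {n} → (Fin n → Bool) → Fin n → Bool → Fin n → Bool
X [ i ]≔ b = updateAt X i (const b)

≔-here : ∀ {n} (X : Fin n → Bool) i b → (X [ i ]≔ b) i ≡ b
≔-here X i b = updateAt-updates i X

≔-elsewhere : ∀ {n} (X : Fin n → Bool) {i l} b → i ≢ l → (X [ i ]≔ b) l ≡ X l
≔-elsewhere X b i≢l = updateAt-minimal _ _ X (≢-sym i≢l)

≔true-⊇ : ∀ {n} (X : Fin n → Bool) i → X ⊆ (X [ i ]≔ true)
≔true-⊇ X i l Xl with i Fin.≟ l
... | yes refl = ≔-here X i true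
... | no  i≢l  = trans (≔-elsewhere X true i≢l) Xl

≔false-⊆ : ∀ {n} (X : Fin n → Bool) i → (X [ i ]≔ false) ⊆ X
≔false-⊆ X i l e with i Fin.≟ l
... | yes refl = ⊥-elim (false≢true (trans (sym (≔-here X i false)) e))
... | no  i≢l  = trans (sym (≔-elsewhere X false i≢l)) e

-- Properties of sets that respect pointwise equality are decided by
-- enumerating the finitely many subsets.
Extensional : ∀ {n} → ((Fin n → Bool) → Set) → Set
Extensional Q = ∀ {X X'} → X ≗ X' → Q X → Q X'

any-subset? : ∀ {n} {Q : (Fin n → Bool) → Set} → Extensional Q →
  (∀ X → Dec (Q X)) → Dec (Σ (Fin n → Bool) Q)
any-subset? resp Q? = map′
  (λ (v , q) → lookup v , q)
  (λ (X , q) → tabulate X , resp (λ j → sym (lookup∘tabulate X j)) q)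
  (anySubset? (Q? ∘ lookup))

all-subsets? : ∀ {n} {Q : (Fin n → Bool) → Set} → Extensional Q →
  (∀ X → Dec (Q X)) → Dec (∀ X → Q X)
all-subsets? {Q = Q} resp Q? = map′
  (λ none X → decidable-stable (Q? X) (λ ¬q → none (X , ¬q)))
  (λ all (X , ¬q) → ¬q (all X))
  (¬? (any-subset? resp¬ (¬? ∘ Q?)))
  where resp¬ : Extensional (λ X → ¬ Q X)
        resp¬ e ¬q q = ¬q (resp (λ j → sym (e j)) q)

-- constant truth values, definable in every fragment
verum falsum : ∀ {k m} → Fml k m
verum  = pos firstg ∨' neg firstg
falsum = pos firstg ∧' neg firstg

_≋_ : ∀ {k m} → Fml k m → Fml k m → Set
_≋_ {k} {m} φ ψ = ∀ (w : Word k) (ρ : Valuation m (len w)) i → ⟦ w ⟧ φ ρ i ⇔ ⟦ w ⟧ ψ ρ i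

module Semantics {k : ℕ} (w : Word k) where

  Val : ℕ → Set
  Val m = Valuation m (len w)

  _⊆ᵛ_ : ∀ {m} → Val m → Val m → Set
  ρ ⊆ᵛ ρ' = ∀ y → ρ y ⊆ ρ' y

  ⊆ᵛ-refl : ∀ {m} {ρ : Val m} → ρ ⊆ᵛ ρ
  ⊆ᵛ-refl _ = ⊆-refl

  ∷-mono : ∀ {m} {X X' : Pos w → Bool} {ρ ρ' : Val m} → X ⊆ X' → ρ ⊆ᵛ ρ' → (X ∷ᵛ ρ) ⊆ᵛ (X' ∷ᵛ ρ')
  ∷-mono X⊆X' _ zero = X⊆X'
  ∷-mono _ ρ⊆ρ' (suc y) = ρ⊆ρ' y

  -- The syntax is positive, so denotations grow with the valuation.
  mono : ∀ {m} (φ : Fml k m) {ρ ρ' : Val m} → ρ ⊆ᵛ ρ' → ∀ i → ⟦ w ⟧ φ ρ i → ⟦ w ⟧ φ ρ' i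
  mono (var y)     h i p = h y i p
  mono (pos A)     h i p = p
  mono (neg A)     h i p = p
  mono (modal M φ) h i (j , st , p) = j , st , mono φ h j p
  mono (φ ∨' ψ)    h i (inj₁ p) = inj₁ (mono φ h i p)
  mono (φ ∨' ψ)    h i (inj₂ p) = inj₂ (mono ψ h i p)
  mono (φ ∧' ψ)    h i (p , q) = mono φ h i p , mono ψ h i q
  mono (μ' φ)      h i p Y pre = p Y (λ j q → pre j (mono φ (∷-mono ⊆-refl h) j q))
  mono (ν' φ)      h i (X , Xi , post) = X , Xi , λ j Xj → mono φ (∷-mono ⊆-refl h) j (post j Xj)

  modal-cong : ∀ M {A B : Pos w → Set} i → (∀ j → Step w M i j → A j ⇔ B j) →
    (Σ (Pos w) λ j → Step w M i j × A j) ⇔ (Σ (Pos w) λ j → Step w M i j × B j)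
  modal-cong M i h = mk⇔ (λ (j , st , a) → j , st , to (h j st) a)
                         (λ (j , st , b) → j , st , from (h j st) b)

  μ-cong : ∀ {m m'} (φ : Fml k (suc m)) (ψ : Fml k (suc m')) {ρ : Val m} {ρ' : Val m'} i →
    (∀ X j → ⟦ w ⟧ φ (X ∷ᵛ ρ) j ⇔ ⟦ w ⟧ ψ (X ∷ᵛ ρ') j) → ⟦ w ⟧ (μ' φ) ρ i ⇔ ⟦ w ⟧ (μ' ψ) ρ' i
  μ-cong φ ψ i h = mk⇔ (λ a X pre → a X (λ j q → pre j (to (h X j) q)))
                       (λ a X pre → a X (λ j q → pre j (from (h X j) q)))

  ν-cong : ∀ {m m'} (φ : Fml k (suc m)) (ψ : Fml k (suc m')) {ρ : Val m} {ρ' : Val m'} i →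
    (∀ X j → ⟦ w ⟧ φ (X ∷ᵛ ρ) j ⇔ ⟦ w ⟧ ψ (X ∷ᵛ ρ') j) → ⟦ w ⟧ (ν' φ) ρ i ⇔ ⟦ w ⟧ (ν' ψ) ρ' i
  ν-cong φ ψ i h = mk⇔ (λ (X , Xi , post) → X , Xi , λ j Xj → to (h X j) (post j Xj))
                       (λ (X , Xi , post) → X , Xi , λ j Xj → from (h X j) (post j Xj))

  ext-∷ : ∀ {m m'} (r : Fin m → Fin m') {ρ : Val m'} {ρ' : Val m} (X : Pos w → Bool) →
    (∀ y l → ρ (r y) l ≡ ρ' y l) → ∀ y l → (X ∷ᵛ ρ) (ext r y) l ≡ (X ∷ᵛ ρ') y l
  ext-∷ r X e zero    l = refl
  ext-∷ r X e (suc y) l = e y l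

  ren-sem : ∀ {m m'} (r : Fin m → Fin m') (φ : Fml k m) {ρ : Val m'} {ρ' : Val m} →
    (∀ y l → ρ (r y) l ≡ ρ' y l) → ∀ i → ⟦ w ⟧ (ren r φ) ρ i ⇔ ⟦ w ⟧ φ ρ' i
  ren-sem r (var y)     e i = mk⇔ (trans (sym (e y i))) (trans (e y i))
  ren-sem r (pos A)     e i = ⇔.refl
  ren-sem r (neg A)     e i = ⇔.refl
  ren-sem r (modal M φ) e i = modal-cong M i (λ j _ → ren-sem r φ e j)
  ren-sem r (φ ∨' ψ)    e i = ren-sem r φ e i ⊎-⇔ ren-sem r ψ e i
  ren-sem r (φ ∧' ψ)    e i = ren-sem r φ e i ×-⇔ ren-sem r ψ e i
  ren-sem r (μ' φ) {ρ} {ρ'} e i =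
    μ-cong (ren (ext r) φ) φ i (λ X → ren-sem (ext r) φ {X ∷ᵛ ρ} {X ∷ᵛ ρ'} (ext-∷ r X e))
  ren-sem r (ν' φ) {ρ} {ρ'} e i =
    ν-cong (ren (ext r) φ) φ i (λ X → ren-sem (ext r) φ {X ∷ᵛ ρ} {X ∷ᵛ ρ'} (ext-∷ r X e))

  exts-∷ : ∀ {m n} (σ : Fin m → Fml k n) {ρ : Val n} {ρ' : Val m} (X : Pos w → Bool) →
    (∀ y l → ⟦ w ⟧ (σ y) ρ l ⇔ (ρ' y l ≡ true)) →
    ∀ y l → ⟦ w ⟧ (exts σ y) (X ∷ᵛ ρ) l ⇔ ((X ∷ᵛ ρ') y l ≡ true)
  exts-∷ σ X h zero    l = ⇔.refl
  exts-∷ σ X h (suc y) l = ⇔.trans (ren-sem suc (σ y) (λ _ _ → refl) l) (h y l)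

  sub-sem : ∀ {m n} (σ : Fin m → Fml k n) (φ : Fml k m) {ρ : Val n} {ρ' : Val m} →
    (∀ y l → ⟦ w ⟧ (σ y) ρ l ⇔ (ρ' y l ≡ true)) → ∀ i → ⟦ w ⟧ (sub σ φ) ρ i ⇔ ⟦ w ⟧ φ ρ' i
  sub-sem σ (var y)     h i = h y i
  sub-sem σ (pos A)     h i = ⇔.refl
  sub-sem σ (neg A)     h i = ⇔.refl
  sub-sem σ (modal M φ) h i = modal-cong M i (λ j _ → sub-sem σ φ h j)
  sub-sem σ (φ ∨' ψ)    h i = sub-sem σ φ h i ⊎-⇔ sub-sem σ ψ h i
  sub-sem σ (φ ∧' ψ)    h i = sub-sem σ φ h i ×-⇔ sub-sem σ ψ h i
  sub-sem σ (μ' φ) {ρ} {ρ'} h i =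
    μ-cong (sub (exts σ) φ) φ i (λ X → sub-sem (exts σ) φ {X ∷ᵛ ρ} {X ∷ᵛ ρ'} (exts-∷ σ X h))
  sub-sem σ (ν' φ) {ρ} {ρ'} h i =
    ν-cong (sub (exts σ) φ) φ i (λ X → sub-sem (exts σ) φ {X ∷ᵛ ρ} {X ∷ᵛ ρ'} (exts-∷ σ X h))

  -- Decidability: words are finite and fixpoints range over finitely many sets.
  classSucc? : ∀ i j → Dec (ClassSucc w i j)
  classSucc? i j = (toℕ i <? toℕ j) ×-dec (dat w j ℕ.≟ dat w i) ×-dec
    all? (λ l → (toℕ i <? toℕ l) →-dec ((toℕ l <? toℕ j) →-dec ¬? (dat w l ℕ.≟ dat w i)))

  succ? : ∀ i j → Dec (Succ w i j)
  succ? i j = toℕ j ℕ.≟ suc (toℕ i)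

  step? : ∀ M i j → Dec (Step w M i j)
  step? Xg i j = succ? i j
  step? Xc i j = classSucc? i j
  step? Yg i j = succ? j i
  step? Yc i j = classSucc? j i

  atom? : (A : Atom k) (i : Pos w) → Dec (⟦ w ⟧ᴬ A i)
  atom? (letter a) i = lab w i Fin.≟ a
  atom? S          i = any? (λ j → succ? i j ×-dec classSucc? i j)
  atom? P          i = any? (λ j → succ? j i ×-dec classSucc? j i)
  atom? firstg     i = toℕ i ℕ.≟ 0
  atom? lastg      i = suc (toℕ i) ℕ.≟ len w
  atom? firstc     i = ¬? (any? (λ j → classSucc? j i))
  atom? lastc      i = ¬? (any? (λ j → classSucc? i j))

  holds? : ∀ {m} (φ : Fml k m) (ρ : Val m) (i : Pos w) → Dec (⟦ w ⟧ φ ρ i)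
  holds? (var y)     ρ i = ρ y i Bool.≟ true
  holds? (pos A)     ρ i = atom? A i
  holds? (neg A)     ρ i = ¬? (atom? A i)
  holds? (modal M φ) ρ i = any? (λ j → step? M i j ×-dec holds? φ ρ j)
  holds? (φ ∨' ψ)    ρ i = holds? φ ρ i ⊎-dec holds? ψ ρ i
  holds? (φ ∧' ψ)    ρ i = holds? φ ρ i ×-dec holds? ψ ρ i
  holds? (μ' φ)      ρ i = all-subsets? resp (λ X → prefixed? X →-dec (X i Bool.≟ true))
    where
    prefixed? : ∀ X → Dec (∀ j → ⟦ w ⟧ φ (X ∷ᵛ ρ) j → X j ≡ true)
    prefixed? X = all? (λ j → holds? φ (X ∷ᵛ ρ) j →-dec (X j Bool.≟ true))
    resp : Extensional (λ X → (∀ j → ⟦ w ⟧ φ (X ∷ᵛ ρ) j → X j ≡ true) → X i ≡ true)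
    resp e h pre = trans (sym (e i))
      (h (λ j q → trans (e j) (pre j (mono φ (∷-mono (≗⇒⊆ e) ⊆ᵛ-refl) j q))))
  holds? (ν' φ)      ρ i = any-subset? resp (λ X → (X i Bool.≟ true) ×-dec postfixed? X)
    where
    postfixed? : ∀ X → Dec (∀ j → X j ≡ true → ⟦ w ⟧ φ (X ∷ᵛ ρ) j)
    postfixed? X = all? (λ j → (X j Bool.≟ true) →-dec holds? φ (X ∷ᵛ ρ) j)
    resp : Extensional (λ X → (X i ≡ true) × (∀ j → X j ≡ true → ⟦ w ⟧ φ (X ∷ᵛ ρ) j))
    resp e (Xi , post) = trans (sym (e i)) Xi ,
      λ j X'j → mono φ (∷-mono (≗⇒⊆ e) ⊆ᵛ-refl) j (post j (trans (e j) X'j))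

  ⟦_⟧ᵇ : ∀ {m} → Fml k m → Val m → Pos w → Bool
  ⟦ φ ⟧ᵇ ρ i = does (holds? φ ρ i)

  ⟦⟧ᵇ-spec : ∀ {m} (φ : Fml k m) ρ i → ⟦ w ⟧ φ ρ i ⇔ (⟦ φ ⟧ᵇ ρ i ≡ true)
  ⟦⟧ᵇ-spec φ ρ i = ⇔.sym (does-true (holds? φ ρ i))

  ⟦_⟧ˢ : ∀ {m n} → (Fin m → Fml k n) → Val n → Val m
  ⟦ σ ⟧ˢ ρ y = ⟦ σ y ⟧ᵇ ρ

  verum-true : ∀ {m} (ρ : Val m) i → ⟦ w ⟧ verum ρ i ⇔ (true ≡ true)
  verum-true ρ i = mk⇔ (λ _ → refl) (λ _ → toSum (atom? firstg i))

  falsum-false : ∀ {m} (ρ : Val m) i → ⟦ w ⟧ falsum ρ i ⇔ (false ≡ true)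
  falsum-false ρ i = mk⇔ (λ (p , ¬p) → ⊥-elim (¬p p)) (λ ())

  -- Unfolding a fixpoint at a single point i: inside ν x.φ the variable may
  -- be taken true at i itself, inside μ x.φ false at i.
  module PointUnfolding {m} (φ : Fml k (suc m)) (η : Val m) where

    V M : Pos w → Bool
    V = ⟦ ν' φ ⟧ᵇ η
    M = ⟦ μ' φ ⟧ᵇ η

    postfixed⊆V : ∀ X → (∀ j → X j ≡ true → ⟦ w ⟧ φ (X ∷ᵛ η) j) → X ⊆ V
    postfixed⊆V X post j Xj = to (⟦⟧ᵇ-spec (ν' φ) η j) (X , Xj , post)

    M⊆prefixed : ∀ Y → (∀ j → ⟦ w ⟧ φ (Y ∷ᵛ η) j → Y j ≡ true) → M ⊆ Y
    M⊆prefixed Y pre j Mj = from (⟦⟧ᵇ-spec (μ' φ) η j) Mj Y pre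

    ν-point : ∀ i → ⟦ w ⟧ φ ((V [ i ]≔ true) ∷ᵛ η) i ⇔ ⟦ w ⟧ (ν' φ) η i
    ν-point i = mk⇔ (λ q → V′ , ≔-here V i true , post q) (λ (X , Xi , postX) → unfold-at X postX i Xi)
      where
      V′ = V [ i ]≔ true
      unfold-at : ∀ X → (∀ j → X j ≡ true → ⟦ w ⟧ φ (X ∷ᵛ η) j) → ∀ j → X j ≡ true → ⟦ w ⟧ φ (V′ ∷ᵛ η) j
      unfold-at X postX j Xj =
        mono φ (∷-mono (λ l → ≔true-⊇ V i l ∘ postfixed⊆V X postX l) ⊆ᵛ-refl) j (postX j Xj)
      post : ⟦ w ⟧ φ (V′ ∷ᵛ η) i → ∀ j → V′ j ≡ true → ⟦ w ⟧ φ (V′ ∷ᵛ η) j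
      post q j e with i Fin.≟ j
      ... | yes refl = q
      ... | no  i≢j  with from (⟦⟧ᵇ-spec (ν' φ) η j) (trans (sym (≔-elsewhere V true i≢j)) e)
      ...   | X , Xj , postX = unfold-at X postX j Xj

    μ-point : ∀ i → ⟦ w ⟧ φ ((M [ i ]≔ false) ∷ᵛ η) i ⇔ ⟦ w ⟧ (μ' φ) η i
    μ-point i = mk⇔ (λ q Y pre → pre i (mono φ (below Y pre) i q)) μ⇒
      where
      M′ = M [ i ]≔ false
      below : ∀ Y → (∀ j → ⟦ w ⟧ φ (Y ∷ᵛ η) j → Y j ≡ true) → (M′ ∷ᵛ η) ⊆ᵛ (Y ∷ᵛ η)
      below Y pre = ∷-mono (λ l → M⊆prefixed Y pre l ∘ ≔false-⊆ M i l) ⊆ᵛ-refl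
      -- if φ failed at i under M′, then M′ would be a smaller pre-fixpoint
      μ⇒ : ⟦ w ⟧ (μ' φ) η i → ⟦ w ⟧ φ (M′ ∷ᵛ η) i
      μ⇒ h with holds? φ (M′ ∷ᵛ η) i
      ... | yes q = q
      ... | no ¬q = ⊥-elim (false≢true (trans (sym (≔-here M i false)) (h M′ prefixed)))
        where
        prefixed : ∀ l → ⟦ w ⟧ φ (M′ ∷ᵛ η) l → M′ l ≡ true
        prefixed l q with i Fin.≟ l
        ... | yes refl = ⊥-elim (¬q q)
        ... | no  i≢l  = trans (≔-elsewhere M false i≢l)
          (to (⟦⟧ᵇ-spec (μ' φ) η l) (λ Y pre → pre l (mono φ (below Y pre) l q)))

    μ⊆ν : ∀ i → ⟦ w ⟧ (μ' φ) η i → ⟦ w ⟧ (ν' φ) η i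
    μ⊆ν i h = M , to (⟦⟧ᵇ-spec (μ' φ) η i) h , M-post
      where
      M-post : ∀ j → M j ≡ true → ⟦ w ⟧ φ (M ∷ᵛ η) j
      M-post j Mj = mono φ (∷-mono (≔false-⊆ M j) ⊆ᵛ-refl) j
        (from (μ-point j) (from (⟦⟧ᵇ-spec (μ' φ) η j) Mj))

sub-cong : ∀ {k m n} {σ τ : Fin m → Fml k n} {ψ ψ' : Fml k m} →
  (∀ y → σ y ≋ τ y) → ψ ≋ ψ' → sub σ ψ ≋ sub τ ψ'
sub-cong {σ = σ} {τ} {ψ} {ψ'} σ≋τ ψ≋ψ' w ρ i = begin
  ⟦ w ⟧ (sub σ ψ) ρ i  ∼⟨ sub-sem σ ψ (λ y l → ⟦⟧ᵇ-spec (σ y) ρ l) i ⟩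
  ⟦ w ⟧ ψ η i          ∼⟨ ψ≋ψ' w η i ⟩
  ⟦ w ⟧ ψ' η i         ∼⟨ ⇔.sym (sub-sem τ ψ' τ-denotes-η i) ⟩
  ⟦ w ⟧ (sub τ ψ') ρ i ∎
  where
  open Semantics w
  η = ⟦ σ ⟧ˢ ρ
  τ-denotes-η : ∀ y l → ⟦ w ⟧ (τ y) ρ l ⇔ (η y l ≡ true)
  τ-denotes-η y l = ⇔.trans (⇔.sym (σ≋τ y w ρ l)) (⟦⟧ᵇ-spec (σ y) ρ l)

data Guarded {k : ℕ} : ∀ {m} → Fin m → Fml k m → Set where
  var   : ∀ {m} {x y : Fin m} → y ≢ x → Guarded x (var y)
  pos   : ∀ {m} {x : Fin m} A → Guarded x (pos A)
  neg   : ∀ {m} {x : Fin m} A → Guarded x (neg A)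
  modal : ∀ {m} {x : Fin m} M {φ} → Guarded x (modal M φ)
  or    : ∀ {m} {x : Fin m} {φ ψ} → Guarded x φ → Guarded x ψ → Guarded x (φ ∨' ψ)
  and   : ∀ {m} {x : Fin m} {φ ψ} → Guarded x φ → Guarded x ψ → Guarded x (φ ∧' ψ)
  mu    : ∀ {m} {x : Fin m} {φ} → Guarded (suc x) φ → Guarded x (μ' φ)
  nu    : ∀ {m} {x : Fin m} {φ} → Guarded (suc x) φ → Guarded x (ν' φ)

module _ {k : ℕ} {m : ℕ} {x : Fin m} where

  unguarded-var : ¬ Guarded {k} x (var x)
  unguarded-var (var x≢x) = x≢x refl

  guarded-∨ : ∀ {φ ψ : Fml k m} → Guarded x (φ ∨' ψ) → Guarded x φ × Guarded x ψ
  guarded-∨ (or g h) = g , h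

  guarded-∧ : ∀ {φ ψ : Fml k m} → Guarded x (φ ∧' ψ) → Guarded x φ × Guarded x ψ
  guarded-∧ (and g h) = g , h

  guarded-μ : ∀ {φ : Fml k (suc m)} → Guarded x (μ' φ) → Guarded (suc x) φ
  guarded-μ (mu g) = g

  guarded-ν : ∀ {φ : Fml k (suc m)} → Guarded x (ν' φ) → Guarded (suc x) φ
  guarded-ν (nu g) = g

_▸_ : ∀ {k m n} → (Fin m → Fml k n) → Fml k n → Fin (suc m) → Fml k n
(σ ▸ t) zero    = t
(σ ▸ t) (suc y) = σ y

▸-all : ∀ {k m n} {P : Fml k n → Set} {σ : Fin m → Fml k n} {t : Fml k n} →
  (∀ y → P (σ y)) → P t → ∀ y → P ((σ ▸ t) y)
▸-all hσ ht zero    = ht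
▸-all hσ ht (suc y) = hσ y

exts-all : ∀ {k m n} {P : FormulaSet k} {σ : Fin m → Fml k n} →
  (∀ {m'} → P {suc m'} (var zero)) → (∀ {m'} {φ : Fml k m'} → P φ → P (ren suc φ)) →
  (∀ y → P (σ y)) → ∀ y → P (exts σ y)
exts-all P0 Pren hσ zero    = P0
exts-all P0 Pren hσ (suc y) = Pren (hσ y)

-- unfold σ c ψ: ψ read at the current position, where a variable under a
-- modality is replaced by σ and an unguarded one by c; an inner fixpoint is
-- unfolded once, its variable standing for the fixpoint itself under a
-- modality and for false (μ) / true (ν) at the current position.
unfold : ∀ {k m n} → (Fin m → Fml k n) → (Fin m → Fml k n) → Fml k m → Fml k n
unfold σ c (var y)     = c y
unfold σ c (pos A)     = pos A
unfold σ c (neg A)     = neg A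
unfold σ c (modal M φ) = modal M (sub σ φ)
unfold σ c (φ ∨' ψ)    = unfold σ c φ ∨' unfold σ c ψ
unfold σ c (φ ∧' ψ)    = unfold σ c φ ∧' unfold σ c ψ
unfold σ c (μ' φ)      = unfold (σ ▸ sub σ (μ' φ)) (c ▸ falsum) φ
unfold σ c (ν' φ)      = unfold (σ ▸ sub σ (ν' φ)) (c ▸ verum) φ

-- guard ψ: the unguarded occurrences of the variable 0 become false
guard : ∀ {k m} → Fml k (suc m) → Fml k (suc m)
guard ψ = unfold var ((λ y → var (suc y)) ▸ falsum) ψ

toNu : ∀ {k m} → Fml k m → Fml k m
toNu (var x)     = var x
toNu (pos A)     = pos A
toNu (neg A)     = neg A
toNu (modal M φ) = modal M (toNu φ)
toNu (φ ∨' ψ)    = toNu φ ∨' toNu ψ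
toNu (φ ∧' ψ)    = toNu φ ∧' toNu ψ
toNu (μ' φ)      = ν' (guard (toNu φ))
toNu (ν' φ)      = ν' (toNu φ)

verum-guarded : ∀ {k m} {x : Fin m} → Guarded x (verum {k})
verum-guarded = or (pos firstg) (neg firstg)

falsum-guarded : ∀ {k m} {x : Fin m} → Guarded x (falsum {k})
falsum-guarded = and (pos firstg) (neg firstg)

unfold-guarded : ∀ {k m n} (σ c : Fin m → Fml k n) (x : Fin n) →
  (∀ y → Guarded x (c y)) → (ψ : Fml k m) → Guarded x (unfold σ c ψ)
unfold-guarded σ c x hc (var y)     = hc y
unfold-guarded σ c x hc (pos A)     = pos A
unfold-guarded σ c x hc (neg A)     = neg A
unfold-guarded σ c x hc (modal M φ) = modal M
unfold-guarded σ c x hc (φ ∨' ψ)    = or (unfold-guarded σ c x hc φ) (unfold-guarded σ c x hc ψ)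
unfold-guarded σ c x hc (φ ∧' ψ)    = and (unfold-guarded σ c x hc φ) (unfold-guarded σ c x hc ψ)
unfold-guarded σ c x hc (μ' φ)      = unfold-guarded _ _ x (▸-all {P = Guarded x} hc falsum-guarded) φ
unfold-guarded σ c x hc (ν' φ)      = unfold-guarded _ _ x (▸-all {P = Guarded x} hc verum-guarded) φ

guard-guarded : ∀ {k m} (ψ : Fml k (suc m)) → Guarded zero (guard ψ)
guard-guarded ψ = unfold-guarded _ _ zero (▸-all {P = Guarded zero} (λ y → var (λ ())) falsum-guarded) ψ

module _ {k : ℕ} {D : Mod → Set} where

  verum-D : ∀ {m} → Formulas D {m} (verum {k})
  verum-D = or (pos firstg) (neg firstg)

  falsum-D : ∀ {m} → Formulas D {m} (falsum {k})
  falsum-D = and (pos firstg) (neg firstg)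

  ren-D : ∀ {m m'} (r : Fin m → Fin m') {φ : Fml k m} → Formulas D φ → Formulas D (ren r φ)
  ren-D r (var x)     = var (r x)
  ren-D r (pos A)     = pos A
  ren-D r (neg A)     = neg A
  ren-D r (modal d f) = modal d (ren-D r f)
  ren-D r (or f g)    = or (ren-D r f) (ren-D r g)
  ren-D r (and f g)   = and (ren-D r f) (ren-D r g)
  ren-D r (mu f)      = mu (ren-D (ext r) f)
  ren-D r (nu f)      = nu (ren-D (ext r) f)

  sub-D : ∀ {m m'} {σ : Fin m → Fml k m'} → (∀ y → Formulas D (σ y)) →
    {φ : Fml k m} → Formulas D φ → Formulas D (sub σ φ)
  sub-D hσ (var x)     = hσ x
  sub-D hσ (pos A)     = pos A
  sub-D hσ (neg A)     = neg A
  sub-D hσ (modal d f) = modal d (sub-D hσ f)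
  sub-D hσ (or f g)    = or (sub-D hσ f) (sub-D hσ g)
  sub-D hσ (and f g)   = and (sub-D hσ f) (sub-D hσ g)
  sub-D hσ (mu f)      = mu (sub-D (exts-all {P = Formulas D} (var zero) (ren-D suc) hσ) f)
  sub-D hσ (nu f)      = nu (sub-D (exts-all {P = Formulas D} (var zero) (ren-D suc) hσ) f)

  unfold-D : ∀ {m n} {σ c : Fin m → Fml k n} → (∀ y → Formulas D (σ y)) → (∀ y → Formulas D (c y)) →
    {ψ : Fml k m} → Formulas D ψ → Formulas D (unfold σ c ψ)
  unfold-D hσ hc (var x)     = hc x
  unfold-D hσ hc (pos A)     = pos A
  unfold-D hσ hc (neg A)     = neg A
  unfold-D hσ hc (modal d f) = modal d (sub-D hσ f)
  unfold-D hσ hc (or f g)    = or (unfold-D hσ hc f) (unfold-D hσ hc g)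
  unfold-D hσ hc (and f g)   = and (unfold-D hσ hc f) (unfold-D hσ hc g)
  unfold-D hσ hc (mu f)      =
    unfold-D (▸-all {P = Formulas D} hσ (sub-D hσ (mu f))) (▸-all {P = Formulas D} hc falsum-D) f
  unfold-D hσ hc (nu f)      =
    unfold-D (▸-all {P = Formulas D} hσ (sub-D hσ (nu f))) (▸-all {P = Formulas D} hc verum-D) f

  guard-D : ∀ {m} {ψ : Fml k (suc m)} → Formulas D ψ → Formulas D (guard ψ)
  guard-D = unfold-D var (▸-all {P = Formulas D} (λ y → var (suc y)) falsum-D)

  toNu-D : ∀ {m} {φ : Fml k m} → Formulas D φ → Formulas D (toNu φ)
  toNu-D (var x)     = var x
  toNu-D (pos A)     = pos A
  toNu-D (neg A)     = neg A
  toNu-D (modal d f) = modal d (toNu-D f)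
  toNu-D (or f g)    = or (toNu-D f) (toNu-D g)
  toNu-D (and f g)   = and (toNu-D f) (toNu-D g)
  toNu-D (mu f)      = nu (guard-D (toNu-D f))
  toNu-D (nu f)      = nu (toNu-D f)

module _ {k : ℕ} where

  verum-ν : ∀ {m} → NuFrag {m = m} (verum {k})
  verum-ν = or (pos firstg) (neg firstg)

  falsum-ν : ∀ {m} → NuFrag {m = m} (falsum {k})
  falsum-ν = and (pos firstg) (neg firstg)

  ren-ν : ∀ {m m'} (r : Fin m → Fin m') {φ : Fml k m} → NuFrag φ → NuFrag (ren r φ)
  ren-ν r (var x)     = var (r x)
  ren-ν r (pos A)     = pos A
  ren-ν r (neg A)     = neg A
  ren-ν r (modal M f) = modal M (ren-ν r f)
  ren-ν r (or f g)    = or (ren-ν r f) (ren-ν r g)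
  ren-ν r (and f g)   = and (ren-ν r f) (ren-ν r g)
  ren-ν r (nu f)      = nu (ren-ν (ext r) f)

  sub-ν : ∀ {m m'} {σ : Fin m → Fml k m'} → (∀ y → NuFrag (σ y)) →
    {φ : Fml k m} → NuFrag φ → NuFrag (sub σ φ)
  sub-ν hσ (var x)     = hσ x
  sub-ν hσ (pos A)     = pos A
  sub-ν hσ (neg A)     = neg A
  sub-ν hσ (modal M f) = modal M (sub-ν hσ f)
  sub-ν hσ (or f g)    = or (sub-ν hσ f) (sub-ν hσ g)
  sub-ν hσ (and f g)   = and (sub-ν hσ f) (sub-ν hσ g)
  sub-ν hσ (nu f)      = nu (sub-ν (exts-all {P = NuFrag} (var zero) (ren-ν suc) hσ) f)

  unfold-ν : ∀ {m n} {σ c : Fin m → Fml k n} → (∀ y → NuFrag (σ y)) → (∀ y → NuFrag (c y)) →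
    {ψ : Fml k m} → NuFrag ψ → NuFrag (unfold σ c ψ)
  unfold-ν hσ hc (var x)     = hc x
  unfold-ν hσ hc (pos A)     = pos A
  unfold-ν hσ hc (neg A)     = neg A
  unfold-ν hσ hc (modal M f) = modal M (sub-ν hσ f)
  unfold-ν hσ hc (or f g)    = or (unfold-ν hσ hc f) (unfold-ν hσ hc g)
  unfold-ν hσ hc (and f g)   = and (unfold-ν hσ hc f) (unfold-ν hσ hc g)
  unfold-ν hσ hc (nu f)      =
    unfold-ν (▸-all {P = NuFrag} hσ (sub-ν hσ (nu f))) (▸-all {P = NuFrag} hc verum-ν) f

  toNu-ν : ∀ {m} (φ : Fml k m) → NuFrag (toNu φ)
  toNu-ν (var x)     = var x
  toNu-ν (pos A)     = pos A
  toNu-ν (neg A)     = neg A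
  toNu-ν (modal M φ) = modal M (toNu-ν φ)
  toNu-ν (φ ∨' ψ)    = or (toNu-ν φ) (toNu-ν ψ)
  toNu-ν (φ ∧' ψ)    = and (toNu-ν φ) (toNu-ν ψ)
  toNu-ν (μ' φ)      = nu (unfold-ν var (▸-all {P = NuFrag} (λ y → var (suc y)) falsum-ν) (toNu-ν φ))
  toNu-ν (ν' φ)      = nu (toNu-ν φ)

record Ranking {k : ℕ} (w : Word k) (D : Mod → Set) : Set where
  field
    rank      : Pos w → ℕ
    rank≤len  : ∀ j → rank j ≤ len w
    rank-step : ∀ {M} → D M → ∀ {i j} → Step w M i j → rank i < rank j

under : ∀ {m} → (Fin m → Set) → Fin (suc m) → Set
under Strict zero    = ⊥
under Strict (suc y) = Strict y

module Ranked {k : ℕ} {w : Word k} {D : Mod → Set} (R : Ranking w D) where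
  open Ranking R
  open Semantics w

  cutoff : Bool → Pos w → (Pos w → Bool) → Pos w → Bool
  cutoff b j X l with rank j ≤? rank l
  ... | yes _ = X l
  ... | no  _ = b

  cutoff-above : ∀ b j X {l} → rank j ≤ rank l → cutoff b j X l ≡ X l
  cutoff-above b j X {l} le with rank j ≤? rank l
  ... | yes _   = refl
  ... | no  ¬le = ⊥-elim (¬le le)

  _⊆[_∣_]_ : ∀ {m} → Val m → ℕ → (Fin m → Set) → Val m → Set
  ρ ⊆[ r ∣ Strict ] ρ' = ∀ y l → r ≤ rank l → (Strict y → r < rank l) → ρ y l ≡ true → ρ' y l ≡ true

  under-⊆ : ∀ {m} {Strict : Fin m → Set} {ρ ρ' : Val m} {X X' : Pos w → Bool} {j l} →
    rank j ≤ rank l → ρ ⊆[ rank j ∣ Strict ] ρ' →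
    (∀ l' → rank j ≤ rank l' → X l' ≡ true → X' l' ≡ true) →
    (X ∷ᵛ ρ) ⊆[ rank l ∣ under Strict ] (X' ∷ᵛ ρ')
  under-⊆ le h hX zero    l' le' _ = hX l' (≤-trans le le')
  under-⊆ le h hX (suc y) l' le' s = h y l' (≤-trans le le') (λ sy → ≤-<-trans le (s sy))

  local : ∀ {m} {φ : Fml k m} → Formulas D φ → (Strict : Fin m → Set) → (∀ y → Strict y → Guarded y φ) →
    ∀ {ρ ρ' : Val m} j → ρ ⊆[ rank j ∣ Strict ] ρ' → ⟦ w ⟧ φ ρ j → ⟦ w ⟧ φ ρ' j
  local (var y) Strict g j h p = h y j ≤-refl (λ s → ⊥-elim (unguarded-var (g y s))) p
  local (pos A) Strict g j h p = p
  local (neg A) Strict g j h p = p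
  local (modal d f) Strict g j h (j' , st , p) =
    j' , st , local f (λ _ → ⊥) (λ _ ()) j'
                (λ y l le _ → h y l (≤-trans (<⇒≤ j<j') le) (λ _ → <-≤-trans j<j' le)) p
    where j<j' = rank-step d st
  local (or f f') Strict g j h (inj₁ p) = inj₁ (local f Strict (λ y → proj₁ ∘ guarded-∨ ∘ g y) j h p)
  local (or f f') Strict g j h (inj₂ p) = inj₂ (local f' Strict (λ y → proj₂ ∘ guarded-∨ ∘ g y) j h p)
  local (and f f') Strict g j h (p , q) =
      local f  Strict (λ y → proj₁ ∘ guarded-∧ ∘ g y) j h p
    , local f' Strict (λ y → proj₂ ∘ guarded-∧ ∘ g y) j h q
  local {φ = μ' φ} (mu f) Strict g {ρ} {ρ'} j h p Y pre =
    trans (sym (cutoff-above true j Y ≤-refl)) (p (cutoff true j Y) pre↓)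
    where
    -- Y, made true below rank j, is a pre-fixpoint under ρ
    pre↓ : ∀ l → ⟦ w ⟧ φ (cutoff true j Y ∷ᵛ ρ) l → cutoff true j Y l ≡ true
    pre↓ l q with rank j ≤? rank l
    ... | no  _  = refl
    ... | yes le = pre l (local f (under Strict) (λ { (suc y) s → guarded-μ (g y s) }) l
                     (under-⊆ le h (λ l' le' → trans (sym (cutoff-above true j Y le')))) q)
  local {φ = ν' φ} (nu f) Strict g {ρ} {ρ'} j h (X , Xj , post) =
    cutoff false j X , trans (cutoff-above false j X ≤-refl) Xj , post↑
    where
    -- X, made false below rank j, is a post-fixpoint under ρ'
    post↑ : ∀ l → cutoff false j X l ≡ true → ⟦ w ⟧ φ (cutoff false j X ∷ᵛ ρ') l
    post↑ l e with rank j ≤? rank l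
    ... | no  _  = ⊥-elim (false≢true e)
    ... | yes le = local f (under Strict) (λ { (suc y) s → guarded-ν (g y s) }) l
                     (under-⊆ le h (λ l' le' → trans (cutoff-above false j X le'))) (post l e)

  local-⇔ : ∀ {m} {φ : Fml k m} → Formulas D φ → ∀ {ρ ρ' : Val m} j →
    (∀ y l → rank j ≤ rank l → (ρ y l ≡ true ⇔ ρ' y l ≡ true)) → ⟦ w ⟧ φ ρ j ⇔ ⟦ w ⟧ φ ρ' j
  local-⇔ f j h = mk⇔ (local f (λ _ → ⊥) (λ _ ()) j (λ y l le _ → to (h y l le)))
                      (local f (λ _ → ⊥) (λ _ ()) j (λ y l le _ → from (h y l le)))

  -- Guarded fixpoints are unique: by downward induction on the rank, every
  -- post-fixpoint lies inside every pre-fixpoint.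
  μ⇔ν : ∀ {m} {φ : Fml k (suc m)} → Formulas D φ → Guarded zero φ → ∀ (η : Val m) i →
    ⟦ w ⟧ (μ' φ) η i ⇔ ⟦ w ⟧ (ν' φ) η i
  μ⇔ν {φ = φ} f g η i = mk⇔ (PointUnfolding.μ⊆ν φ η i) ν⇒μ
    where
    ν⇒μ : ⟦ w ⟧ (ν' φ) η i → ⟦ w ⟧ (μ' φ) η i
    ν⇒μ (X , Xi , post) Y pre = X⊆Y (suc (len w ∸ rank i)) i ≤-refl Xi
      where
      X⊆Y : ∀ t j → len w ∸ rank j < t → X j ≡ true → Y j ≡ true
      X⊆Y zero    j ()
      X⊆Y (suc t) j (s≤s bound) Xj = pre j (local f (_≡ zero) (λ { _ refl → g }) j step (post j Xj))
        where
        step : (X ∷ᵛ η) ⊆[ rank j ∣ _≡ zero ] (Y ∷ᵛ η)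
        step zero    l _ above = X⊆Y t l (<-≤-trans (∸-monoʳ-< (above refl) (rank≤len l)) bound)
        step (suc y) l _ _     = id

  Above : ∀ {m n} → Pos w → (Fin m → Fml k n) → Val n → Val m → Set
  Above i σ ρ η = ∀ y l → rank i < rank l → ⟦ w ⟧ (σ y) ρ l ⇔ (η y l ≡ true)

  Here : ∀ {m n} → Pos w → (Fin m → Fml k n) → Val n → Val m → Set
  Here i c ρ η = ∀ y → ⟦ w ⟧ (c y) ρ i ⇔ (η y i ≡ true)

  sub-above : ∀ {m n} {φ : Fml k m} → Formulas D φ → ∀ {σ : Fin m → Fml k n} {ρ η} i →
    Above i σ ρ η → ∀ l → rank i < rank l → ⟦ w ⟧ (sub σ φ) ρ l ⇔ ⟦ w ⟧ φ η l
  sub-above {φ = φ} f {σ} {ρ} i hσ l i<l = ⇔.trans (sub-sem σ φ (λ y l' → ⟦⟧ᵇ-spec (σ y) ρ l') l)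
    (local-⇔ f l (λ y l' le → ⇔.trans (⇔.sym (⟦⟧ᵇ-spec (σ y) ρ l')) (hσ y l' (<-≤-trans i<l le))))

  ≡-⇔ : ∀ {a b : Bool} → a ≡ b → (a ≡ true) ⇔ (b ≡ true)
  ≡-⇔ a≡b = mk⇔ (trans (sym a≡b)) (trans a≡b)

  fixpoint-above : ∀ {m n} {θ : Fml k m} → Formulas D θ → ∀ {σ : Fin m → Fml k n} {ρ η} i b →
    Above i σ ρ η → Above i (σ ▸ sub σ θ) ρ ((⟦ θ ⟧ᵇ η [ i ]≔ b) ∷ᵛ η)
  fixpoint-above {θ = θ} f {η = η} i b hσ zero l i<l =
    ⇔.trans (sub-above f i hσ l i<l) (⇔.trans (⟦⟧ᵇ-spec θ η l)
      (≡-⇔ (sym (≔-elsewhere (⟦ θ ⟧ᵇ η) b (λ i≡l → <-irrefl (cong rank i≡l) i<l)))))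
  fixpoint-above f i b hσ (suc y) = hσ y

  fixpoint-here : ∀ {m n} {c : Fin m → Fml k n} {ρ η} (F : Pos w → Bool) i b (t : Fml k n) →
    (⟦ w ⟧ t ρ i ⇔ (b ≡ true)) → Here i c ρ η → Here i (c ▸ t) ρ ((F [ i ]≔ b) ∷ᵛ η)
  fixpoint-here F i b t ht hc zero    = ⇔.trans ht (≡-⇔ (sym (≔-here F i b)))
  fixpoint-here F i b t ht hc (suc y) = hc y

  unfold-sem : ∀ {m n} {ψ : Fml k m} → Formulas D ψ → ∀ {σ c : Fin m → Fml k n} {ρ η} i →
    Above i σ ρ η → Here i c ρ η → ⟦ w ⟧ (unfold σ c ψ) ρ i ⇔ ⟦ w ⟧ ψ η i
  unfold-sem (var y)     i hσ hc = hc y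
  unfold-sem (pos A)     i hσ hc = ⇔.refl
  unfold-sem (neg A)     i hσ hc = ⇔.refl
  unfold-sem {ψ = modal M φ} (modal d f) i hσ hc =
    modal-cong M i (λ j st → sub-above f i hσ j (rank-step d st))
  unfold-sem (or f g)    i hσ hc = unfold-sem f i hσ hc ⊎-⇔ unfold-sem g i hσ hc
  unfold-sem (and f g)   i hσ hc = unfold-sem f i hσ hc ×-⇔ unfold-sem g i hσ hc
  unfold-sem {ψ = μ' φ} (mu f) {ρ = ρ} {η} i hσ hc = ⇔.trans
    (unfold-sem f i (fixpoint-above (mu f) i false hσ)
                    (fixpoint-here M i false falsum (falsum-false ρ i) hc))
    (μ-point i)
    where open PointUnfolding φ η
  unfold-sem {ψ = ν' φ} (nu f) {ρ = ρ} {η} i hσ hc = ⇔.trans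
    (unfold-sem f i (fixpoint-above (nu f) i true hσ)
                    (fixpoint-here V i true verum (verum-true ρ i) hc))
    (ν-point i)
    where open PointUnfolding φ η

  guard-point : ∀ {m} {ψ : Fml k (suc m)} → Formulas D ψ → ∀ X (η : Val m) i → X i ≡ false →
    ⟦ w ⟧ (guard ψ) (X ∷ᵛ η) i ⇔ ⟦ w ⟧ ψ (X ∷ᵛ η) i
  guard-point f X η i Xi = unfold-sem f i (λ y l _ → ⇔.refl) here
    where
    here : Here i ((λ y → var (suc y)) ▸ falsum) (X ∷ᵛ η) (X ∷ᵛ η)
    here zero    = ⇔.trans (falsum-false (X ∷ᵛ η) i) (≡-⇔ (sym Xi))
    here (suc y) = ⇔.refl

  -- hence μ x.ψ and μ x.guard ψ have the same pre-fixpoints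
  μ-guard : ∀ {m} {ψ : Fml k (suc m)} → Formulas D ψ → ∀ (η : Val m) i →
    ⟦ w ⟧ (μ' ψ) η i ⇔ ⟦ w ⟧ (μ' (guard ψ)) η i
  μ-guard f η i = mk⇔
    (λ h Y pre → h Y (λ j q → true-unless-false (Y j) (λ Yj → pre j (from (guard-point f Y η j Yj) q))))
    (λ h Y pre → h Y (λ j q → true-unless-false (Y j) (λ Yj → pre j (to (guard-point f Y η j Yj) q))))

  toNu-sem : ∀ {m} {φ : Fml k m} → Formulas D φ → ∀ (ρ : Val m) i → ⟦ w ⟧ φ ρ i ⇔ ⟦ w ⟧ (toNu φ) ρ i
  toNu-sem (var x)   ρ i = ⇔.refl
  toNu-sem (pos A)   ρ i = ⇔.refl
  toNu-sem (neg A)   ρ i = ⇔.refl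
  toNu-sem {φ = modal M φ} (modal d f) ρ i = modal-cong M i (λ j _ → toNu-sem f ρ j)
  toNu-sem (or f g)  ρ i = toNu-sem f ρ i ⊎-⇔ toNu-sem g ρ i
  toNu-sem (and f g) ρ i = toNu-sem f ρ i ×-⇔ toNu-sem g ρ i
  toNu-sem {φ = μ' φ} (mu f) ρ i = begin
    ⟦ w ⟧ (μ' φ) ρ i                ∼⟨ μ-cong φ (toNu φ) i (λ X → toNu-sem f (X ∷ᵛ ρ)) ⟩
    ⟦ w ⟧ (μ' (toNu φ)) ρ i         ∼⟨ μ-guard (toNu-D f) ρ i ⟩
    ⟦ w ⟧ (μ' (guard (toNu φ))) ρ i ∼⟨ μ⇔ν (guard-D (toNu-D f)) (guard-guarded (toNu φ)) ρ i ⟩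
    ⟦ w ⟧ (ν' (guard (toNu φ))) ρ i ∎
  toNu-sem {φ = ν' φ} (nu f) ρ i = ν-cong φ (toNu φ) i (λ X → toNu-sem f (X ∷ᵛ ρ))

-- Future steps increase the position, past steps decrease it.
futureRanking : ∀ {k} (w : Word k) → Ranking w Future
futureRanking w = record { rank = toℕ ; rank≤len = λ j → <⇒≤ (toℕ<n j) ; rank-step = step }
  where
  step : ∀ {M} → Future M → ∀ {i j} → Step w M i j → toℕ i < toℕ j
  step (inj₁ refl) st = proj₁ st
  step (inj₂ refl) st = ≤-reflexive (sym st)

pastRanking : ∀ {k} (w : Word k) → Ranking w Past
pastRanking w = record
  { rank = λ j → len w ∸ toℕ j ; rank≤len = λ j → m∸n≤m (len w) (toℕ j) ; rank-step = step }
  where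
  step : ∀ {M} → Past M → ∀ {i j} → Step w M i j → len w ∸ toℕ i < len w ∸ toℕ j
  step (inj₁ refl) {i} st = ∸-monoʳ-< (proj₁ st) (<⇒≤ (toℕ<n i))
  step (inj₂ refl) {i} st = ∸-monoʳ-< (≤-reflexive (sym st)) (<⇒≤ (toℕ<n i))

generator-toNu : ∀ {k m} {φ : Fml k m} → BRgen φ → φ ≋ toNu φ
generator-toNu (inj₁ f) w ρ i = Ranked.toNu-sem (futureRanking w) f ρ i
generator-toNu (inj₂ f) w ρ i = Ranked.toNu-sem (pastRanking w) f ρ i

-- Induction on the composition depth: substitute ν-equivalents of the
-- arguments into the ν-translation of the generator.
comp-ν : ∀ {k} i (φ : Fml k 0) → CompN BRgen i φ → Σ (Fml k 0) λ ψ → NuFrag ψ × φ ≋ ψ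
comp-ν zero    φ ()
comp-ν {k} (suc i) .(sub σ ψ) (m , ψ , gen , σ , args , refl) =
    sub τ (toNu ψ)
  , sub-ν (proj₁ ∘ proj₂ ∘ ih) (toNu-ν ψ)
  , sub-cong {σ = σ} {τ} {ψ} {toNu ψ} (proj₂ ∘ proj₂ ∘ ih) (generator-toNu gen)
  where
  ih : ∀ y → Σ (Fml k 0) λ ψ → NuFrag ψ × σ y ≋ ψ
  ih y = comp-ν i (σ y) (args y)
  τ : Fin m → Fml k 0
  τ = proj₁ ∘ ih

theorem6 : (k : ℕ) (φ : Fml k 0) → BR φ →
    Σ (Fml k 0) λ ψ → NuFrag ψ × Equiv φ ψ
theorem6 k φ (i , φ∈Compⁱ) with comp-ν i φ φ∈Compⁱ
... | ψ , ψ∈ν , φ≋ψ = ψ , ψ∈ν , λ w j → to (φ≋ψ w emptyVal j) , from (φ≋ψ w emptyVal j)
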